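{- Let $f(z)=Az^2+Bz+C\in\mathbb{Z}[z]$ with $A>0$, $\gcd(A,B,C)=1$ and $D=B^2-4AC$ not a perfect square, and let $\mathcal S$ be an arithmetic progression containing infinitely many primes $p$ with $\big(\frac Dp\big)=1$. For each integer $a$ with $1\le a\le A$, let $\mathcal Z_a=\{p\in\mathcal S \text{ prime}:\ \exists\, n\in\mathbb{Z}_{>0}\text{ with } f(n)=ap^2\}$ and $T_a(x)=\#\{p\le x: p\in\mathcal Z_a\}$. Then $T_a(x)=o(\pi(x))$ as $x\to\infty$.
   Context: $\pi(x)$ is the prime counting function; $(\frac Dp)$ is the Legendre symbol. -}

module Defs where

open import Data.Nat as ℕ using (ℕ; zero; suc; _≤_; _<_)
open import Data.Nat.Primality using (Prime; prime?)
open import Data.Integer as ℤ using (ℤ; +_)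
open import Data.Integer.GCD using (gcd)
import Data.Integer.Divisibility as ℤd
open import Data.List using (List; length; filter; upTo)
open import Data.List.Relation.Unary.All using (All)
open import Data.List.Relation.Unary.Unique.Propositional using (Unique)
open import Data.Product using (Σ; ∃; _×_)
open import Relation.Binary.PropositionalEquality using (_≡_; _≢_)
open import Relation.Nullary using (¬_)

quad : ℤ → ℤ → ℤ → ℤ → ℤ
quad A B C z = A ℤ.* z ℤ.* z ℤ.+ B ℤ.* z ℤ.+ C

disc : ℤ → ℤ → ℤ → ℤ
disc A B C = B ℤ.* B ℤ.- (+ 4) ℤ.* A ℤ.* C

primeCount : ℕ → ℕ
primeCount x = length (filter prime? (upTo (suc x)))

LegendreOne : ℤ → ℕ → Set
LegendreOne D p =
  Prime p × p ≢ 2 × ¬ ((+ p) ℤd.∣ D) × ∃ λ (y : ℤ) → (+ p) ℤd.∣ (y ℤ.* y ℤ.- D)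

InAP : ℕ → ℕ → ℕ → Set
InAP b d n = ∃ λ (k : ℕ) → n ≡ b ℕ.+ d ℕ.* k

InZ : ℤ → ℤ → ℤ → ℕ → ℕ → ℕ → ℕ → Set
InZ A B C b d a p =
  Prime p × InAP b d p ×
  ∃ λ (n : ℕ) → 1 ≤ n × quad A B C (+ n) ≡ (+ a) ℤ.* (+ p) ℤ.* (+ p)

-- "c · #{p ≤ x : P p} ≤ m", phrased without needing decidability of P:
-- every duplicate-free list of elements p ≤ x of P has c · length ≤ m
ScaledCountBounded : (ℕ → Set) → ℕ → ℕ → ℕ → Set
ScaledCountBounded P x c m =
  (L : List ℕ) → Unique L → All (λ p → p ≤ x × P p) L → c ℕ.* length L ≤ m

module Submission where

-- We prove the stronger, effective statement
-- T_a(x) = O(log x) and compare it with Chebyshev's lower bound for π(x). Only A > 0,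
-- a ≥ 1 and D ≠ 0 (because D is not a square) are needed.
--
--  * Completing the square turns f(n) = a p² into the generalised Pell equation
--    U² = E p² + D with U = |2An + B| and E = 4Aa.
--  * Pell rigidity: two solutions with p₁, p₂ ≥ |D| in the same dyadic range and with
--    U₁ ≡ U₂, p₁ ≡ p₂ (mod |D|) coincide, since X = U₁p₂ and Y = U₂p₁ are congruent mod |D|
--    while |X² − Y²| < |D|(X + Y).
--  * So the key (binary length of p, U mod |D|, p mod |D|) is injective on Z_a ∩ [1, x] and,
--    by pigeonhole, T_a(x) ≤ (|D| + |D|²)(⌊log₂ x⌋ + 1).
--  * Chebyshev: every i ≤ n divides Q(n) = ∏_{p ≤ n} (largest power of p that is ≤ n), hence
--    so does each m·C(n,m), and 2^n = Σ_m C(n,m) ≤ (n+1)·Q(n) ≤ (n+1)·n^π(n).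

open import Defs
open import Data.Nat as ℕ using (ℕ; suc; _≤_; _<_)
open import Data.Integer as ℤ using (ℤ; +_)
open import Data.Integer.GCD using (gcd)
open import Data.Product using (∃; _×_)
open import Relation.Binary.PropositionalEquality using (_≡_; _≢_)

open import Data.Nat
open import Data.Nat.Properties
open import Data.Nat.Divisibility
open import Data.Nat.DivMod using (m≡m%n+[m/n]*n; %-distribˡ-*; m%n<n; [m+kn]%n≡m%n; m<n⇒m%n≡m)
open import Data.Nat.Primality using (Prime; prime?; prime⇒irreducible; prime⇒nonTrivial; prime⇒nonZero)
open import Data.Nat.Primality.Factorisation using (factorise)
open import Data.Nat.Coprimality using (Coprime; coprime-divisor)
open import Data.Nat.ListAction using (product)
open import Data.Nat.ListAction.Properties using (∈⇒∣product; product≢0)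
open import Data.Nat.Induction using (<-wellFounded)
open import Data.Nat.Tactic.RingSolver using (solve-∀)
open import Induction.WellFounded using (Acc; acc)
open import Data.Integer using (-[1+_]; ∣_∣)
import Data.Integer.Properties as ℤP
import Data.Integer.Tactic.RingSolver as ℤSolver
open import Data.Fin as Fin using (Fin; fromℕ<; toℕ)
open import Data.Fin.Properties using (injective⇒≤; toℕ-fromℕ<)
open import Data.List using (List; []; _∷_; _++_; map; filter; upTo; length; lookup)
open import Data.List.Properties using (length-map; upTo-∷ʳ; filter-++; length-++)
open import Data.List.Relation.Unary.All as All using (All; []; _∷_)
open import Data.List.Relation.Unary.All.Properties using (all-filter; map⁺)
open import Data.List.Relation.Unary.AllPairs using (_∷_)
open import Data.List.Relation.Unary.Unique.Propositional using (Unique)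
open import Data.List.Membership.Propositional using (_∈_)
open import Data.List.Membership.Propositional.Properties using (∈-map⁺; ∈-filter⁺; ∈-upTo⁺)
open import Data.Product using (∃₂; _,_; proj₁; proj₂)
open import Data.Sum as Sum using (_⊎_; inj₁; inj₂)
open import Relation.Binary.PropositionalEquality using (refl; sym; trans; cong; cong₂; subst; subst₂; module ≡-Reasoning)
open import Relation.Nullary using (¬_; yes; no)
open import Data.Empty using (⊥-elim)

1<2 : 1 < 2
1<2 = s≤s (s≤s z≤n)

ilog : ℕ → ℕ → ℕ
ilog b zero = 0
ilog b (suc n) with b ^ suc (ilog b n) ≤? suc n
... | yes _ = suc (ilog b n)
... | no _ = ilog b n

ilog-bounds : ∀ {b} → 1 < b → ∀ n → b ^ ilog b (suc n) ≤ suc n × suc n < b ^ suc (ilog b (suc n))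
ilog-bounds {b} 1<b zero with b ^ 1 ≤? 1
... | yes b≤1 = ⊥-elim (<⇒≱ 1<b (subst (_≤ 1) (*-identityʳ b) b≤1))
... | no b≰1 = ≤-refl , ≰⇒> b≰1
ilog-bounds {b} 1<b (suc n) with ilog-bounds 1<b n | b ^ suc (ilog b (suc n)) ≤? suc (suc n)
... | _ , n<b^k+1 | yes b^k+1≤n = b^k+1≤n , ≤-<-trans n<b^k+1 (^-monoʳ-< b 1<b (n<1+n (suc (ilog b (suc n)))))
... | b^k≤n , _ | no b^k+1≰n = m≤n⇒m≤1+n b^k≤n , ≰⇒> b^k+1≰n

^-reflectʳ-< : ∀ b .{{_ : NonZero b}} {m n} → b ^ m < b ^ n → m < n
^-reflectʳ-< b {m} {n} b^m<b^n with m <? n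
... | yes m<n = m<n
... | no m≮n = ⊥-elim (<⇒≱ b^m<b^n (^-monoʳ-≤ b (≮⇒≥ m≮n)))

^-reflectʳ-≤ : ∀ {b m n} → 1 < b → b ^ m ≤ b ^ n → m ≤ n
^-reflectʳ-≤ {b} {m} {n} 1<b b^m≤b^n with m ≤? n
... | yes m≤n = m≤n
... | no m≰n = ⊥-elim (<⇒≱ (^-monoʳ-< b 1<b (≰⇒> m≰n)) b^m≤b^n)

^-∣ : ∀ b {j i} → j ≤ i → b ^ j ∣ b ^ i
^-∣ b {j} {i} j≤i = divides (b ^ (i ∸ j)) (begin
  b ^ i             ≡⟨ cong (b ^_) (m∸n+n≡m j≤i) ⟨
  b ^ (i ∸ j + j)   ≡⟨ ^-distribˡ-+-* b (i ∸ j) j ⟩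
  b ^ (i ∸ j) * b ^ j ∎)
  where open ≡-Reasoning

module _ {b} (1<b : 1 < b) where

  private instance
    b≢0 : NonZero b
    b≢0 = >-nonZero (<-trans z<s 1<b)

  ilog-lower : ∀ {n} → 1 ≤ n → b ^ ilog b n ≤ n
  ilog-lower (s≤s z≤n) = proj₁ (ilog-bounds 1<b _)

  ilog-upper : ∀ {n} → 1 ≤ n → n < b ^ suc (ilog b n)
  ilog-upper (s≤s z≤n) = proj₂ (ilog-bounds 1<b _)

  ilog-maximal : ∀ {n j} → 1 ≤ n → b ^ j ≤ n → j ≤ ilog b n
  ilog-maximal 1≤n b^j≤n = s≤s⁻¹ (^-reflectʳ-< b (≤-<-trans b^j≤n (ilog-upper 1≤n)))

  ilog-mono : ∀ {m n} → 1 ≤ m → m ≤ n → ilog b m ≤ ilog b n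
  ilog-mono 1≤m m≤n = ilog-maximal (≤-trans 1≤m m≤n) (≤-trans (ilog-lower 1≤m) m≤n)

ilog₂-close : ∀ {m n} → 1 ≤ m → 1 ≤ n → ilog 2 m ≡ ilog 2 n → m < 2 * n
ilog₂-close {m} {n} 1≤m 1≤n same = <-≤-trans (ilog-upper 1<2 1≤m)
  (subst (λ e → 2 ^ suc e ≤ 2 * n) (sym same) (*-monoʳ-≤ 2 (ilog-lower 1<2 1≤n)))

-- If 1/c₁ = 1/c₂ + 1/c (i.e. c·c₂ = c₁·(c₂ + c)) and c₁, c₂ divide Q, then so does c,
-- because Q/c = Q/c₁ − Q/c₂.
∣-harmonic : ∀ {c₁ c₂ c Q} .{{_ : NonZero c₂}} → c * c₂ ≡ c₁ * (c₂ + c) →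
  c₁ ∣ Q → c₂ ∣ Q → c ∣ Q
∣-harmonic {c₁} {c₂} {c} {Q} eq (divides α Q≡αc₁) (divides β Q≡βc₂) =
  ∣m+n∣m⇒∣n c∣βc+Q (∣n⇒∣m*n β ∣-refl)
  where
  open ≡-Reasoning
  scaled : c₂ * (c * α) ≡ c₂ * (β * c + Q)
  scaled = begin
    c₂ * (c * α)              ≡⟨ regroup c₂ c α ⟩
    (c * c₂) * α              ≡⟨ cong (_* α) eq ⟩
    c₁ * (c₂ + c) * α         ≡⟨ distrib c₁ c₂ c α ⟩
    (α * c₁) * c₂ + (α * c₁) * c ≡⟨ cong (λ u → u * c₂ + u * c) (sym Q≡αc₁) ⟩
    Q * c₂ + Q * c            ≡⟨ cong (λ u → Q * c₂ + u * c) Q≡βc₂ ⟩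
    Q * c₂ + (β * c₂) * c     ≡⟨ collect β c₂ Q c ⟩
    c₂ * (β * c + Q) ∎
    where
    regroup : ∀ a b c → a * (b * c) ≡ (b * a) * c
    regroup = solve-∀
    distrib : ∀ a b c d → a * (b + c) * d ≡ (d * a) * b + (d * a) * c
    distrib = solve-∀
    collect : ∀ b c q e → q * c + (b * c) * e ≡ c * (b * e + q)
    collect = solve-∀
  c∣βc+Q : c ∣ β * c + Q
  c∣βc+Q = divides α (trans (sym (*-cancelˡ-≡ _ _ c₂ scaled)) (*-comm c α))

-- Binomial coefficients (kept in their own module: the operator _C_ would clash with the
-- variable name C of the main statement).
module Binomial where

  open import Data.Nat.Combinatorics using (_C_; nC1≡n; k>n⇒nCk≡0; nCk+nC[k+1]≡[n+1]C[k+1])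

  sumBelow : (ℕ → ℕ) → ℕ → ℕ
  sumBelow f zero = 0
  sumBelow f (suc K) = sumBelow f K + f K

  sumBelow-≤ : ∀ (f : ℕ → ℕ) {Q} → (∀ m → f m ≤ Q) → ∀ K → sumBelow f K ≤ K * Q
  sumBelow-≤ f bound zero = z≤n
  sumBelow-≤ f {Q} bound (suc K) =
    ≤-trans (+-mono-≤ (sumBelow-≤ f bound K) (bound K)) (≤-reflexive (+-comm (K * Q) Q))

  row-sum-step : ∀ n K → sumBelow (suc n C_) (suc K) ≡ sumBelow (n C_) (suc K) + sumBelow (n C_) K
  row-sum-step n zero = refl
  row-sum-step n (suc K) = begin
    sumBelow (suc n C_) (suc K) + suc n C suc K
      ≡⟨ cong₂ _+_ (row-sum-step n K) (sym (nCk+nC[k+1]≡[n+1]C[k+1] n K)) ⟩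
    (S (suc K) + S K) + (n C K + n C suc K)
      ≡⟨ swap (S (suc K)) (S K) (n C K) (n C suc K) ⟩
    (S (suc K) + n C suc K) + (S K + n C K) ∎
    where
    open ≡-Reasoning
    S = sumBelow (n C_)
    swap : ∀ a b c d → (a + b) + (c + d) ≡ (a + d) + (b + c)
    swap = solve-∀

  binomial-row-sum : ∀ n → sumBelow (n C_) (suc n) ≡ 2 ^ n
  binomial-row-sum zero = refl
  binomial-row-sum (suc n) = begin
    sumBelow (suc n C_) (suc (suc n))                       ≡⟨ row-sum-step n (suc n) ⟩
    (sumBelow (n C_) (suc n) + n C suc n) + sumBelow (n C_) (suc n)
      ≡⟨ cong₂ (λ s t → (s + t) + s) (binomial-row-sum n) (k>n⇒nCk≡0 (n<1+n n)) ⟩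
    (2 ^ n + 0) + 2 ^ n                                     ≡⟨ double (2 ^ n) ⟩
    2 ^ suc n ∎
    where
    open ≡-Reasoning
    double : ∀ x → (x + 0) + x ≡ 2 * x
    double = solve-∀

  binomial-pos : ∀ {n k} → k ≤ n → 1 ≤ n C k
  binomial-pos {k = zero} _ = ≤-refl
  binomial-pos {suc n} {suc k} (s≤s k≤n) =
    subst (1 ≤_) (nCk+nC[k+1]≡[n+1]C[k+1] n k) (≤-trans (binomial-pos k≤n) (m≤m+n _ _))

  absorption : ∀ n k → suc k * (suc n C suc k) ≡ suc n * (n C k)
  absorption zero zero = refl
  absorption zero (suc k) = begin
    (2 + k) * (1 C (2 + k)) ≡⟨ cong ((2 + k) *_) (k>n⇒nCk≡0 {1} {2 + k} (s≤s (s≤s z≤n))) ⟩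
    (2 + k) * 0             ≡⟨ *-zeroʳ (2 + k) ⟩
    0                       ≡⟨ cong (1 *_) (k>n⇒nCk≡0 {0} {suc k} (s≤s z≤n)) ⟨
    1 * (0 C suc k) ∎
    where open ≡-Reasoning
  absorption (suc n) zero = begin
    1 * (suc (suc n) C 1) ≡⟨ cong (1 *_) (nC1≡n (suc (suc n))) ⟩
    1 * suc (suc n)       ≡⟨ *-comm 1 (suc (suc n)) ⟩
    suc (suc n) * 1 ∎
    where open ≡-Reasoning
  absorption (suc n) (suc k) = begin
    (2 + k) * (suc (suc n) C (2 + k))
      ≡⟨ cong ((2 + k) *_) (sym (nCk+nC[k+1]≡[n+1]C[k+1] (suc n) (suc k))) ⟩
    (2 + k) * (suc n C suc k + suc n C (2 + k))
      ≡⟨ split (suc k) (suc n C suc k) (suc n C (2 + k)) ⟩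
    suc k * (suc n C suc k) + suc n C suc k + (2 + k) * (suc n C (2 + k))
      ≡⟨ cong₂ (λ u v → u + suc n C suc k + v) (absorption n k) (absorption n (suc k)) ⟩
    suc n * (n C k) + suc n C suc k + suc n * (n C suc k)
      ≡⟨ cong (λ u → suc n * (n C k) + u + suc n * (n C suc k)) (sym (nCk+nC[k+1]≡[n+1]C[k+1] n k)) ⟩
    suc n * (n C k) + (n C k + n C suc k) + suc n * (n C suc k)
      ≡⟨ merge n (n C k) (n C suc k) ⟩
    (2 + n) * (n C k + n C suc k)
      ≡⟨ cong ((2 + n) *_) (nCk+nC[k+1]≡[n+1]C[k+1] n k) ⟩
    (2 + n) * (suc n C suc k) ∎
    where
    open ≡-Reasoning
    split : ∀ j x y → suc j * (x + y) ≡ j * x + x + suc j * y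
    split = solve-∀
    merge : ∀ n x y → suc n * x + (x + y) + suc n * y ≡ (2 + n) * (x + y)
    merge = solve-∀

  -- The weighted binomial coefficient m·C(n,m); it is the denominator of the Beta integral
  -- ∫ x^(m-1) (1-x)^(n-m) dx, which explains the harmonic relation below.
  wbinom : ℕ → ℕ → ℕ
  wbinom n m = m * (n C m)

  -- 1/w(r, s+1) = 1/w(r+1, s+1) + 1/w(r+1, s+2), written without fractions.
  wbinom-harmonic : ∀ r s →
    wbinom (suc r) (2 + s) * wbinom (suc r) (suc s) ≡
    wbinom r (suc s) * (wbinom (suc r) (suc s) + wbinom (suc r) (2 + s))
  wbinom-harmonic r s = begin
    wbinom (suc r) (2 + s) * w₁₁            ≡⟨ cong (_* w₁₁) (absorption r (suc s)) ⟩
    suc r * R * w₁₁                         ≡⟨ cong (λ u → suc r * R * (suc s * u)) (sym (nCk+nC[k+1]≡[n+1]C[k+1] r s)) ⟩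
    suc r * R * (suc s * (P + R))           ≡⟨ rearrange r s P R ⟩
    suc s * R * (suc r * P + suc r * R)
      ≡⟨ cong₂ (λ u v → suc s * R * (u + v)) (sym (absorption r s)) (sym (absorption r (suc s))) ⟩
    suc s * R * (w₁₁ + wbinom (suc r) (2 + s)) ∎
    where
    open ≡-Reasoning
    P = r C s
    R = r C suc s
    w₁₁ = wbinom (suc r) (suc s)
    rearrange : ∀ r s P R → suc r * R * (suc s * (P + R)) ≡ suc s * R * (suc r * P + suc r * R)
    rearrange = solve-∀

  module _ {N Q} (multiple : ∀ i → 1 ≤ i → i ≤ N → i ∣ Q) where

    wbinom-∣ : ∀ n m → n ≤ N → m < n → wbinom n (suc m) ∣ Q
    wbinom-∣ n zero n≤N 1≤n =
      subst (_∣ Q) (sym (trans (*-identityˡ (n C 1)) (nC1≡n n))) (multiple n 1≤n n≤N)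
    wbinom-∣ (suc r) (suc s) r≤N (s≤s s<r) =
      ∣-harmonic (wbinom-harmonic r s)
        (wbinom-∣ r s (≤-trans (n≤1+n r) r≤N) s<r) (wbinom-∣ (suc r) s r≤N (m<n⇒m<1+n s<r))
      where instance
      _ : NonZero (suc r C suc s)
      _ = >-nonZero (binomial-pos (<⇒≤ (s≤s s<r)))
      _ : NonZero (wbinom (suc r) (suc s))
      _ = m*n≢0 (suc s) (suc r C suc s)

    binomial-≤ : .{{NonZero Q}} → ∀ m → N C m ≤ Q
    binomial-≤ zero = >-nonZero⁻¹ Q
    binomial-≤ (suc m) with suc m ≤? N
    ... | yes m<N = ≤-trans (m≤n*m (N C suc m) (suc m)) (∣⇒≤ (wbinom-∣ N m ≤-refl m<N))
    ... | no m≮N = ≤-trans (≤-reflexive (k>n⇒nCk≡0 (≰⇒> m≮N))) z≤n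

    two-pow-≤ : .{{NonZero Q}} → 2 ^ N ≤ suc N * Q
    two-pow-≤ = subst (_≤ suc N * Q) (binomial-row-sum N) (sumBelow-≤ (N C_) binomial-≤ (suc N))

open Binomial using (two-pow-≤)

prime>1 : ∀ {p} → Prime p → 1 < p
prime>1 {p} pr = nonTrivial⇒n>1 p {{prime⇒nonTrivial pr}}

prime-divisor : ∀ n → ∃ λ p → Prime p × p ∣ 2 + n
prime-divisor n with factorise (2 + n)
... | record { factors = [] ; isFactorisation = () }
... | record { factors = p ∷ ps ; isFactorisation = eq ; factorsPrime = pr ∷ _ } =
  p , pr , subst (p ∣_) (sym eq) (m∣m*n (product ps))

p-split : ∀ {p} .{{_ : NonTrivial p}} i .{{_ : NonZero i}} → Acc _<_ i →
  ∃₂ λ j r → i ≡ p ^ j * r × ¬ p ∣ r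
p-split {p} i (acc smaller) with p ∣? i
... | no p∤i = 0 , i , sym (*-identityˡ i) , p∤i
... | yes p∣i with p-split (quotient p∣i) {{quotient≢0 p∣i}} (smaller (quotient-< p∣i))
...   | j , r , q≡pʲr , p∤r =
  suc j , r , trans (m∣n⇒n≡quotient*m p∣i) (trans (cong (_* p) q≡pʲr) (reorder (p ^ j) r p)) , p∤r
  where
  reorder : ∀ a r p → a * r * p ≡ p * a * r
  reorder = solve-∀

∤⇒coprime : ∀ {p r} → Prime p → ¬ p ∣ r → Coprime r p
∤⇒coprime pr p∤r (d∣r , d∣p) with prime⇒irreducible pr d∣p
... | inj₁ d≡1 = d≡1
... | inj₂ refl = ⊥-elim (p∤r d∣r)

coprime-divisor-^ : ∀ {r p} → Coprime r p → ∀ e {x} → r ∣ p ^ e * x → r ∣ x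
coprime-divisor-^ {r} cop zero {x} r∣x = subst (r ∣_) (*-identityˡ x) r∣x
coprime-divisor-^ {r} {p} cop (suc e) {x} r∣ppᵉx =
  coprime-divisor-^ cop e (coprime-divisor cop (subst (r ∣_) (*-assoc p (p ^ e) x) r∣ppᵉx))

primesUpTo : ℕ → List ℕ
primesUpTo n = filter prime? (upTo (suc n))

prime-∈ : ∀ {p n} → Prime p → p ≤ n → p ∈ primesUpTo n
prime-∈ pr p≤n = ∈-filter⁺ prime? (∈-upTo⁺ (s≤s p≤n)) pr

maxPow : ℕ → ℕ → ℕ
maxPow n p = p ^ ilog p n

-- Q(n) = ∏_{p ≤ n prime} (largest power of p that is ≤ n): a common multiple of 1, …, n
-- which is at most n^π(n).
commonMultiple : ℕ → ℕ
commonMultiple n = product (map (maxPow n) (primesUpTo n))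

product-≤ : ∀ {n xs} → All (_≤ n) xs → product xs ≤ n ^ length xs
product-≤ [] = ≤-refl
product-≤ (x≤n ∷ xs≤n) = *-mono-≤ x≤n (product-≤ xs≤n)

commonMultiple-≤ : ∀ {n} → 1 ≤ n → commonMultiple n ≤ n ^ primeCount n
commonMultiple-≤ {n} 1≤n = subst (λ l → commonMultiple n ≤ n ^ l) (length-map (maxPow n) (primesUpTo n))
  (product-≤ (map⁺ (All.map (λ pr → ilog-lower (prime>1 pr) 1≤n) (all-filter prime? (upTo (suc n))))))

commonMultiple≢0 : ∀ n → NonZero (commonMultiple n)
commonMultiple≢0 n = product≢0 (map⁺ (All.map (λ {p} pr → m^n≢0 p (ilog p n) {{prime⇒nonZero pr}}) (all-filter prime? (upTo (suc n)))))

-- Every 1 ≤ i ≤ n divides Q(n): write i = p^j·r with p a prime factor of i and p ∤ r;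
-- then p^j ≤ n divides the p-factor of Q(n), and r < i divides the cofactor.
∣commonMultiple : ∀ {n} i → Acc _<_ i → 1 ≤ i → i ≤ n → i ∣ commonMultiple n
∣commonMultiple (suc zero) _ _ _ = 1∣ _
∣commonMultiple {n} i@(suc (suc k)) (acc smaller) _ i≤n with prime-divisor k
... | p , pr , p∣i with p-split {p} {{prime⇒nonTrivial pr}} i (<-wellFounded i)
...   | zero , r , i≡r , p∤r = ⊥-elim (p∤r (subst (p ∣_) (trans i≡r (*-identityˡ r)) p∣i))
...   | suc j , zero , _ , p∤0 = ⊥-elim (p∤0 (p ∣0))
...   | suc j , r@(suc _) , i≡pʲr , p∤r with ∈⇒∣product (∈-map⁺ (maxPow n) (prime-∈ pr (≤-trans (∣⇒≤ p∣i) i≤n)))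
...     | divides R Q≡R*pᵉ = subst (_∣ commonMultiple n) (sym i≡pʲr)
  (subst (p ^ suc j * r ∣_) (trans (*-comm (maxPow n p) R) (sym Q≡R*pᵉ)) (*-pres-∣ pʲ∣pᵉ r∣R))
  where
  1<p = prime>1 pr
  pʲ>1 : 1 < p ^ suc j
  pʲ>1 = ^-monoʳ-< p 1<p {0} {suc j} z<s
  r<i : r < i
  r<i = subst (r <_) (trans (*-comm r (p ^ suc j)) (sym i≡pʲr)) (m<m*n r (p ^ suc j) pʲ>1)
  pʲ∣pᵉ : p ^ suc j ∣ maxPow n p
  pʲ∣pᵉ = ^-∣ p {suc j} (ilog-maximal 1<p (≤-trans (s≤s z≤n) i≤n)
    (≤-trans (m≤m*n (p ^ suc j) r) (≤-trans (≤-reflexive (sym i≡pʲr)) i≤n)))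
  r∣R : r ∣ R
  r∣R = coprime-divisor-^ (∤⇒coprime pr p∤r) (ilog p n)
    (subst (r ∣_) (trans Q≡R*pᵉ (*-comm R (maxPow n p))) (∣commonMultiple r (smaller r<i) (s≤s z≤n) (≤-trans (<⇒≤ r<i) i≤n)))

chebyshev : ∀ {n} → 1 ≤ n → 2 ^ n ≤ suc n * n ^ primeCount n
chebyshev {n} 1≤n = ≤-trans
  (two-pow-≤ {n} (λ i 1≤i i≤n → ∣commonMultiple i (<-wellFounded i) 1≤i i≤n) {{commonMultiple≢0 n}})
  (*-monoʳ-≤ (suc n) (commonMultiple-≤ 1≤n))

chebyshev-dyadic : ∀ J → 2 ^ J ≤ suc J + J * primeCount (2 ^ J)
chebyshev-dyadic J = ^-reflectʳ-≤ 1<2 (≤-trans (chebyshev (m^n>0 2 J)) (begin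
  suc N * N ^ π           ≤⟨ *-monoˡ-≤ (N ^ π) (+-monoˡ-≤ N (m^n>0 2 J)) ⟩
  (N + N) * N ^ π         ≡⟨ cong₂ _*_ (cong (_+_ N) (sym (+-identityʳ N))) (^-*-assoc 2 J π) ⟩
  2 ^ suc J * 2 ^ (J * π) ≡⟨ ^-distribˡ-+-* 2 (suc J) (J * π) ⟨
  2 ^ (suc J + J * π) ∎))
  where
  open ≤-Reasoning
  N = 2 ^ J
  π = primeCount N

cube-≤ : ∀ J → suc J * suc J * suc J ≤ 8 * 2 ^ J
cube-≤ 0 = s≤s z≤n
cube-≤ 1 = m≤m+n 8 8
cube-≤ 2 = m≤m+n 27 5
cube-≤ 3 = ≤-refl
cube-≤ (suc (suc (suc (suc t)))) = begin
  (5 + t) * (5 + t) * (5 + t)      ≤⟨ m≤m+n _ (t * t * t + 9 * t * t + 21 * t + 3) ⟩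
  _                                ≡⟨ step t ⟩
  2 * ((4 + t) * (4 + t) * (4 + t)) ≤⟨ *-monoʳ-≤ 2 (cube-≤ (suc (suc (suc t)))) ⟩
  2 * (8 * 2 ^ (3 + t))            ≡⟨ *-comm 2 (8 * 2 ^ (3 + t)) ⟩
  8 * 2 ^ (3 + t) * 2              ≡⟨ trans (*-assoc 8 (2 ^ (3 + t)) 2) (cong (8 *_) (*-comm (2 ^ (3 + t)) 2)) ⟩
  8 * 2 ^ (4 + t) ∎
  where
  open ≤-Reasoning
  step : ∀ t → (5 + t) * (5 + t) * (5 + t) + (t * t * t + 9 * t * t + 21 * t + 3) ≡ 2 * ((4 + t) * (4 + t) * (4 + t))
  step = solve-∀

-- If 2^J ≤ (J+1) + J·π with J ≥ 1 and 8M ≤ J + 1, then M·(J+1) ≤ π: multiplying out,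
-- J·M(J+1) + (J+1) ≤ M(J+1)² ≤ 2^J by the cube bound, and J cancels.
log-linear-bound : ∀ M {J π} → 1 ≤ J → 8 * M ≤ suc J → 2 ^ J ≤ suc J + J * π → M * suc J ≤ π
log-linear-bound zero _ _ _ = z≤n
log-linear-bound (suc M′) {J} {π} 1≤J 8M≤J+1 cheb =
  *-cancelˡ-≤ J {{>-nonZero 1≤J}} (+-cancelʳ-≤ (suc J) _ _ (begin
    J * (M * suc J) + suc J   ≤⟨ +-monoʳ-≤ (J * (M * suc J)) (m≤m*n (suc J) M) ⟩
    J * (M * suc J) + suc J * M ≡⟨ expand M J ⟩
    M * (suc J * suc J)       ≤⟨ *-cancelˡ-≤ 8 eightfold ⟩
    2 ^ J                     ≤⟨ cheb ⟩
    suc J + J * π             ≡⟨ +-comm (suc J) (J * π) ⟩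
    J * π + suc J ∎))
  where
  open ≤-Reasoning
  M = suc M′
  expand : ∀ M J → J * (M * suc J) + suc J * M ≡ M * (suc J * suc J)
  expand = solve-∀
  eightfold : 8 * (M * (suc J * suc J)) ≤ 8 * 2 ^ J
  eightfold = begin
    8 * (M * (suc J * suc J)) ≡⟨ *-assoc 8 M _ ⟨
    8 * M * (suc J * suc J)   ≤⟨ *-monoˡ-≤ (suc J * suc J) 8M≤J+1 ⟩
    suc J * (suc J * suc J)   ≡⟨ *-assoc (suc J) (suc J) (suc J) ⟨
    suc J * suc J * suc J     ≤⟨ cube-≤ J ⟩
    8 * 2 ^ J ∎

primeCount-suc : ∀ n → primeCount n ≤ primeCount (suc n)
primeCount-suc n = begin
  length (filter prime? (upTo (suc n)))                           ≤⟨ m≤m+n _ _ ⟩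
  length (filter prime? (upTo (suc n))) + length (filter prime? (suc n ∷ []))
    ≡⟨ length-++ (filter prime? (upTo (suc n))) ⟨
  length (filter prime? (upTo (suc n)) ++ filter prime? (suc n ∷ []))
    ≡⟨ cong length (filter-++ prime? (upTo (suc n)) (suc n ∷ [])) ⟨
  length (filter prime? (upTo (suc n) ++ suc n ∷ []))
    ≡⟨ cong (λ l → length (filter prime? l)) (upTo-∷ʳ (suc n)) ⟩
  primeCount (suc n) ∎
  where open ≤-Reasoning

primeCount-mono : ∀ {m n} → m ≤ n → primeCount m ≤ primeCount n
primeCount-mono {n = zero} z≤n = ≤-refl
primeCount-mono {m} {suc n} m≤1+n with m≤n⇒m<n∨m≡n m≤1+n
... | inj₁ m<1+n = ≤-trans (primeCount-mono (s≤s⁻¹ m<1+n)) (primeCount-suc n)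
... | inj₂ refl = ≤-refl

primeCount-beats-log : ∀ M → ∃ λ X → ∀ x → X ≤ x → M * suc (ilog 2 x) ≤ primeCount x
primeCount-beats-log M = 2 ^ suc (8 * M) , beats
  where
  beats : ∀ x → 2 ^ suc (8 * M) ≤ x → M * suc (ilog 2 x) ≤ primeCount x
  beats x X≤x = ≤-trans
    (log-linear-bound M (≤-trans (s≤s z≤n) 8M<e) (m≤n⇒m≤1+n (<⇒≤ 8M<e)) (chebyshev-dyadic e))
    (primeCount-mono (ilog-lower 1<2 1≤x))
    where
    1≤x = ≤-trans (m^n>0 2 (suc (8 * M))) X≤x
    e = ilog 2 x
    8M<e : 8 * M < e
    8M<e = s≤s⁻¹ (^-reflectʳ-< 2 (≤-<-trans X≤x (ilog-upper 1<2 1≤x)))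

square-reflects-≤ : ∀ {a b} → a * a ≤ b * b → a ≤ b
square-reflects-≤ {a} {b} a²≤b² with a ≤? b
... | yes a≤b = a≤b
... | no a≰b = ⊥-elim (<⇒≱ (*-mono-< (≰⇒> a≰b) (≰⇒> a≰b)) a²≤b²)

square-injective : ∀ {a b} → a * a ≡ b * b → a ≡ b
square-injective a²≡b² = ≤-antisym (square-reflects-≤ (≤-reflexive a²≡b²)) (square-reflects-≤ (≤-reflexive (sym a²≡b²)))

n≤n*n : ∀ n → n ≤ n * n
n≤n*n zero = z≤n
n≤n*n n@(suc _) = m≤m*n n n

%-≡⇒∣∸ : ∀ {d X Y} .{{_ : NonZero d}} → X % d ≡ Y % d → d ∣ Y ∸ X
%-≡⇒∣∸ {d} {X} {Y} same-rem = divides (Y / d ∸ X / d) (begin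
  Y ∸ X                                         ≡⟨ cong₂ _∸_ (m≡m%n+[m/n]*n Y d) (m≡m%n+[m/n]*n X d) ⟩
  (Y % d + Y / d * d) ∸ (X % d + X / d * d)     ≡⟨ cong (λ r → (Y % d + Y / d * d) ∸ (r + X / d * d)) same-rem ⟩
  (Y % d + Y / d * d) ∸ (Y % d + X / d * d)     ≡⟨ [m+n]∸[m+o]≡n∸o (Y % d) _ _ ⟩
  Y / d * d ∸ X / d * d                         ≡⟨ *-distribʳ-∸ d (Y / d) (X / d) ⟨
  (Y / d ∸ X / d) * d ∎)
  where open ≡-Reasoning

square-of-sum : ∀ X e → (X + e) * (X + e) ≡ X * X + e * (X + (X + e))
square-of-sum = solve-∀

-- Two distinct squares that are congruent mod d are at least d(X+Y) apart:
-- if X < Y then Y² − X² = (Y−X)(X+Y) with d ∣ Y − X.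
congruent-squares-≤ : ∀ {d X Y P Q} .{{_ : NonZero d}} → X ≤ Y → X % d ≡ Y % d →
  X * X + d * P ≡ Y * Y + d * Q → P < X + Y → X ≡ Y
congruent-squares-≤ {d} {X} {Y} {P} {Q} X≤Y same-rem eq P<X+Y with m≤n⇒m<n∨m≡n X≤Y
... | inj₂ X≡Y = X≡Y
... | inj₁ X<Y = ⊥-elim (<⇒≱ (*-monoʳ-< d P<X+Y) (begin
  d * (X + Y)           ≤⟨ *-monoˡ-≤ (X + Y) (∣⇒≤ {{>-nonZero (m<n⇒0<n∸m X<Y)}} (%-≡⇒∣∸ same-rem)) ⟩
  e * (X + Y)           ≤⟨ m≤m+n (e * (X + Y)) (d * Q) ⟩
  e * (X + Y) + d * Q   ≡⟨ +-cancelˡ-≡ (X * X) _ _ expand ⟨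
  d * P ∎))
  where
  open ≤-Reasoning
  e = Y ∸ X
  expand : X * X + d * P ≡ X * X + (e * (X + Y) + d * Q)
  expand = begin-equality
    X * X + d * P                     ≡⟨ eq ⟩
    Y * Y + d * Q                     ≡⟨ cong (λ y → y * y + d * Q) (m+[n∸m]≡n X≤Y) ⟨
    (X + e) * (X + e) + d * Q         ≡⟨ cong (_+ d * Q) (square-of-sum X e) ⟩
    X * X + e * (X + (X + e)) + d * Q ≡⟨ cong (λ y → X * X + e * (X + y) + d * Q) (m+[n∸m]≡n X≤Y) ⟩
    X * X + e * (X + Y) + d * Q       ≡⟨ +-assoc (X * X) _ _ ⟩
    X * X + (e * (X + Y) + d * Q) ∎

congruent-squares : ∀ {d X Y P Q} .{{_ : NonZero d}} → X % d ≡ Y % d →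
  X * X + d * P ≡ Y * Y + d * Q → P < X + Y → Q < X + Y → P ≡ Q
congruent-squares {d} {X} {Y} {P} {Q} same-rem eq P<X+Y Q<X+Y =
  *-cancelˡ-≡ P Q d (+-cancelˡ-≡ (X * X) _ _ (subst (λ y → X * X + d * P ≡ y * y + d * Q) (sym X≡Y) eq))
  where
  X≡Y : X ≡ Y
  X≡Y with ≤-total X Y
  ... | inj₁ X≤Y = congruent-squares-≤ X≤Y same-rem eq P<X+Y
  ... | inj₂ Y≤X = sym (congruent-squares-≤ Y≤X (sym same-rem) (sym eq) (subst (Q <_) (+-comm X Y) Q<X+Y))

-- Generalised Pell equation U² = E p² + D in natural numbers: U² + D⁻ = E p² + D⁺.
-- Cross-multiplying two solutions gives (U₁p₂)² + (D⁻p₂² + D⁺p₁²) = (U₂p₁)² + (D⁻p₁² + D⁺p₂²).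
cross-multiply : ∀ {E neg pos U p} q → U * U + neg ≡ E * (p * p) + pos →
  (U * q) * (U * q) + (neg * (q * q) + pos * (p * p)) ≡ E * (p * p) * (q * q) + pos * (p * p + q * q)
cross-multiply {E} {neg} {pos} {U} {p} q sol = begin
  (U * q) * (U * q) + (neg * (q * q) + pos * (p * p)) ≡⟨ factor U q neg pos (p * p) ⟩
  (U * U + neg) * (q * q) + pos * (p * p)             ≡⟨ cong (λ s → s * (q * q) + pos * (p * p)) sol ⟩
  (E * (p * p) + pos) * (q * q) + pos * (p * p)       ≡⟨ expand E (p * p) (q * q) pos ⟩
  E * (p * p) * (q * q) + pos * (p * p + q * q) ∎
  where
  open ≡-Reasoning
  factor : ∀ U q n m s → (U * q) * (U * q) + (n * (q * q) + m * s) ≡ (U * U + n) * (q * q) + m * s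
  factor = solve-∀
  expand : ∀ E s t m → (E * s + m) * t + m * s ≡ E * s * t + m * (s + t)
  expand = solve-∀

cross-identity : ∀ E neg pos U₁ U₂ p₁ p₂ →
  U₁ * U₁ + neg ≡ E * (p₁ * p₁) + pos → U₂ * U₂ + neg ≡ E * (p₂ * p₂) + pos →
  (U₁ * p₂) * (U₁ * p₂) + (neg * (p₂ * p₂) + pos * (p₁ * p₁)) ≡
  (U₂ * p₁) * (U₂ * p₁) + (neg * (p₁ * p₁) + pos * (p₂ * p₂))
cross-identity E neg pos U₁ U₂ p₁ p₂ sol₁ sol₂ =
  trans (cross-multiply {E} {neg} {pos} {U₁} {p₁} p₂ sol₁)
    (trans (cong₂ (λ s t → s + pos * t) (swap E (p₁ * p₁) (p₂ * p₂)) (+-comm (p₁ * p₁) (p₂ * p₂)))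
      (sym (cross-multiply {E} {neg} {pos} {U₂} {p₂} p₁ sol₂)))
  where
  swap : ∀ E s t → E * s * t ≡ E * t * s
  swap = solve-∀

solution-large : ∀ {E neg pos} U p → 2 ≤ E → neg ≤ p → U * U + neg ≡ E * (p * p) + pos → p ≤ U
solution-large {E} {neg} {pos} U p 2≤E neg≤p sol = square-reflects-≤ (+-cancelʳ-≤ (p * p) _ _ (begin
  p * p + p * p    ≡⟨ cong (λ s → p * p + s) (+-identityʳ (p * p)) ⟨
  2 * (p * p)      ≤⟨ *-monoˡ-≤ (p * p) 2≤E ⟩
  E * (p * p)      ≤⟨ m≤m+n (E * (p * p)) pos ⟩
  E * (p * p) + pos ≡⟨ sol ⟨
  U * U + neg      ≤⟨ +-monoʳ-≤ (U * U) (≤-trans neg≤p (n≤n*n p)) ⟩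
  U * U + p * p ∎))
  where open ≤-Reasoning

square-<-cross : ∀ {a b U V} → 1 ≤ a → a < 2 * b → a ≤ U → b ≤ V → a * a < U * b + V * a
square-<-cross {a} {b} {U} {V} 1≤a a<2b a≤U b≤V = begin-strict
  a * a         <⟨ *-monoˡ-< a {{>-nonZero 1≤a}} a<2b ⟩
  2 * b * a     ≡⟨ split a b ⟩
  a * b + b * a ≤⟨ +-mono-≤ (*-monoˡ-≤ b a≤U) (*-monoˡ-≤ a b≤V) ⟩
  U * b + V * a ∎
  where
  open ≤-Reasoning
  split : ∀ a b → 2 * b * a ≡ a * b + b * a
  split = solve-∀

-- Rigidity of the generalised Pell equation: two solutions (U₁, p₁), (U₂, p₂) with
-- p₁, p₂ within a factor 2 of each other and U, p congruent modulo d coincide,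
-- because the cross-multiplied squares (U₁p₂)², (U₂p₁)² are congruent mod d but too close.
pell-rigidity-ℕ : ∀ {d U₁ U₂ p₁ p₂} .{{_ : NonZero d}} → p₁ ≤ U₁ → p₂ ≤ U₂ → 1 ≤ p₁ → 1 ≤ p₂ →
  p₁ < 2 * p₂ → p₂ < 2 * p₁ → U₁ % d ≡ U₂ % d → p₁ % d ≡ p₂ % d →
  (U₁ * p₂) * (U₁ * p₂) + d * (p₁ * p₁) ≡ (U₂ * p₁) * (U₂ * p₁) + d * (p₂ * p₂) ⊎
  (U₁ * p₂) * (U₁ * p₂) + d * (p₂ * p₂) ≡ (U₂ * p₁) * (U₂ * p₁) + d * (p₁ * p₁) →
  p₁ ≡ p₂
pell-rigidity-ℕ {d} {U₁} {U₂} {p₁} {p₂} p₁≤U₁ p₂≤U₂ 1≤p₁ 1≤p₂ p₁<2p₂ p₂<2p₁ U-rem p-rem cross =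
  square-injective (Sum.[ (λ eq → congruent-squares XY-rem eq p₁²<X+Y p₂²<X+Y)
                        , (λ eq → sym (congruent-squares XY-rem eq p₂²<X+Y p₁²<X+Y)) ] cross)
  where
  XY-rem : (U₁ * p₂) % d ≡ (U₂ * p₁) % d
  XY-rem = begin
    (U₁ * p₂) % d               ≡⟨ %-distribˡ-* U₁ p₂ d ⟩
    ((U₁ % d) * (p₂ % d)) % d   ≡⟨ cong₂ (λ u v → (u * v) % d) U-rem (sym p-rem) ⟩
    ((U₂ % d) * (p₁ % d)) % d   ≡⟨ %-distribˡ-* U₂ p₁ d ⟨
    (U₂ * p₁) % d ∎
    where open ≡-Reasoning
  p₁²<X+Y : p₁ * p₁ < U₁ * p₂ + U₂ * p₁
  p₁²<X+Y = square-<-cross 1≤p₁ p₁<2p₂ p₁≤U₁ p₂≤U₂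
  p₂²<X+Y : p₂ * p₂ < U₁ * p₂ + U₂ * p₁
  p₂²<X+Y = subst (p₂ * p₂ <_) (+-comm (U₂ * p₁) (U₁ * p₂)) (square-<-cross 1≤p₂ p₂<2p₁ p₂≤U₂ p₁≤U₁)

posPart negPart : ℤ → ℕ
posPart (+ n) = n
posPart -[1+ n ] = 0
negPart (+ n) = 0
negPart -[1+ n ] = suc n

ℕ-form : ∀ D E U p → + (U * U) ≡ + (E * (p * p)) ℤ.+ D → U * U + negPart D ≡ E * (p * p) + posPart D
ℕ-form (+ n) E U p sol = trans (+-identityʳ (U * U)) (ℤP.+-injective (trans sol (sym (ℤP.pos-+ (E * (p * p)) n))))
ℕ-form -[1+ n ] E U p sol = ℤP.+-injective (begin
  + (U * U + suc n)                          ≡⟨ ℤP.pos-+ (U * U) (suc n) ⟩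
  + (U * U) ℤ.+ + suc n                      ≡⟨ cong (ℤ._+ + suc n) sol ⟩
  (+ (E * (p * p)) ℤ.+ -[1+ n ]) ℤ.+ + suc n ≡⟨ cancel (+ (E * (p * p))) (+ suc n) ⟩
  + (E * (p * p))                            ≡⟨ cong +_ (+-identityʳ (E * (p * p))) ⟨
  + (E * (p * p) + 0) ∎)
  where
  open ≡-Reasoning
  cancel : ∀ x y → (x ℤ.+ ℤ.- y) ℤ.+ y ≡ x
  cancel = ℤSolver.solve-∀

pell-rigidity : ∀ D E U₁ U₂ p₁ p₂ .{{_ : NonZero ∣ D ∣}} → 2 ≤ E →
  + (U₁ * U₁) ≡ + (E * (p₁ * p₁)) ℤ.+ D → + (U₂ * U₂) ≡ + (E * (p₂ * p₂)) ℤ.+ D →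
  ∣ D ∣ ≤ p₁ → ∣ D ∣ ≤ p₂ → p₁ < 2 * p₂ → p₂ < 2 * p₁ →
  U₁ % ∣ D ∣ ≡ U₂ % ∣ D ∣ → p₁ % ∣ D ∣ ≡ p₂ % ∣ D ∣ → p₁ ≡ p₂
pell-rigidity D@(+ suc _) E U₁ U₂ p₁ p₂ 2≤E sol₁ sol₂ d≤p₁ d≤p₂ p₁<2p₂ p₂<2p₁ U-rem p-rem =
  pell-rigidity-ℕ (solution-large U₁ p₁ 2≤E z≤n sol₁′) (solution-large U₂ p₂ 2≤E z≤n sol₂′)
    (≤-trans (s≤s z≤n) d≤p₁) (≤-trans (s≤s z≤n) d≤p₂) p₁<2p₂ p₂<2p₁ U-rem p-rem
    (inj₁ (cross-identity E 0 (posPart D) U₁ U₂ p₁ p₂ sol₁′ sol₂′))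
  where
  sol₁′ : U₁ * U₁ + negPart D ≡ E * (p₁ * p₁) + posPart D
  sol₁′ = ℕ-form D E U₁ p₁ sol₁
  sol₂′ : U₂ * U₂ + negPart D ≡ E * (p₂ * p₂) + posPart D
  sol₂′ = ℕ-form D E U₂ p₂ sol₂
pell-rigidity D@(-[1+ k ]) E U₁ U₂ p₁ p₂ 2≤E sol₁ sol₂ d≤p₁ d≤p₂ p₁<2p₂ p₂<2p₁ U-rem p-rem =
  pell-rigidity-ℕ (solution-large U₁ p₁ 2≤E d≤p₁ sol₁′) (solution-large U₂ p₂ 2≤E d≤p₂ sol₂′)
    (≤-trans (s≤s z≤n) d≤p₁) (≤-trans (s≤s z≤n) d≤p₂) p₁<2p₂ p₂<2p₁ U-rem p-rem
    (inj₂ (subst₂ (λ s t → (U₁ * p₂) * (U₁ * p₂) + s ≡ (U₂ * p₁) * (U₂ * p₁) + t)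
      (+-identityʳ (suc k * (p₂ * p₂))) (+-identityʳ (suc k * (p₁ * p₁)))
      (cross-identity E (negPart D) 0 U₁ U₂ p₁ p₂ sol₁′ sol₂′)))
  where
  sol₁′ : U₁ * U₁ + negPart D ≡ E * (p₁ * p₁) + posPart D
  sol₁′ = ℕ-form D E U₁ p₁ sol₁
  sol₂′ : U₂ * U₂ + negPart D ≡ E * (p₂ * p₂) + posPart D
  sol₂′ = ℕ-form D E U₂ p₂ sol₂

lookup-All : ∀ {P : ℕ → Set} {xs} → All P xs → (i : Fin (length xs)) → P (lookup xs i)
lookup-All (px ∷ _) Fin.zero = px
lookup-All (_ ∷ pxs) (Fin.suc i) = lookup-All pxs i

lookup-injective : ∀ {xs : List ℕ} → Unique xs → ∀ i j → lookup xs i ≡ lookup xs j → i ≡ j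
lookup-injective (_ ∷ _) Fin.zero Fin.zero _ = refl
lookup-injective (x∉xs ∷ _) Fin.zero (Fin.suc j) x≡xⱼ = ⊥-elim (lookup-All x∉xs j x≡xⱼ)
lookup-injective (x∉xs ∷ _) (Fin.suc i) Fin.zero xᵢ≡x = ⊥-elim (lookup-All x∉xs i (sym xᵢ≡x))
lookup-injective (_ ∷ u) (Fin.suc i) (Fin.suc j) eq = cong Fin.suc (lookup-injective u i j eq)

pigeonhole : ∀ {P : ℕ → Set} S (key : ∀ {y} → P y → ℕ) → (∀ {y} (h : P y) → key h < S) →
  (∀ {y z} (h : P y) (h′ : P z) → key h ≡ key h′ → y ≡ z) →
  ∀ {L} → Unique L → All P L → length L ≤ S
pigeonhole S key key<S key-injective {L} unique all = injective⇒≤ {f = slot} slot-injective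
  where
  slot : Fin (length L) → Fin S
  slot i = fromℕ< (key<S (lookup-All all i))
  slot-injective : ∀ {i j} → slot i ≡ slot j → i ≡ j
  slot-injective {i} {j} eq = lookup-injective unique i j (key-injective _ _
    (trans (sym (toℕ-fromℕ< _)) (trans (cong toℕ eq) (toℕ-fromℕ< _))))

digit-injective : ∀ {d r s a b} .{{_ : NonZero d}} → r < d → s < d → r + a * d ≡ s + b * d → r ≡ s × a ≡ b
digit-injective {d} {r} {s} {a} {b} r<d s<d eq = r≡s , *-cancelʳ-≡ a b d (+-cancelˡ-≡ r _ _ (trans eq (cong (_+ b * d) (sym r≡s))))
  where
  r≡s : r ≡ s
  r≡s = begin
    r               ≡⟨ m<n⇒m%n≡m r<d ⟨
    r % d           ≡⟨ [m+kn]%n≡m%n r a d ⟨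
    (r + a * d) % d ≡⟨ cong (_% d) eq ⟩
    (s + b * d) % d ≡⟨ [m+kn]%n≡m%n s b d ⟩
    s % d           ≡⟨ m<n⇒m%n≡m s<d ⟩
    s ∎
    where open ≡-Reasoning

-- The key of a solution (p, U) of a Pell-type equation modulo d: a p < d is its own key;
-- a larger p is recorded by its binary length, U mod d and p mod d (offset by d).
solutionKey : ∀ d .{{_ : NonZero d}} → ℕ → ℕ → ℕ
solutionKey d p U with p <? d
... | yes _ = p
... | no _ = d + (p % d + (U % d + ilog 2 p * d) * d)

solutionKey-< : ∀ d .{{_ : NonZero d}} p U J → ilog 2 p ≤ J → solutionKey d p U < (d + d * d) * suc J
solutionKey-< d p U J len≤J with p <? d
... | yes p<d = <-≤-trans p<d (≤-trans (m≤m*n d (suc J)) (≤-trans (m≤m+n _ _) (≤-reflexive (sym (*-distribʳ-+ (suc J) d (d * d))))))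
... | no _ = begin-strict
  d + (p % d + (U % d + ilog 2 p * d) * d) <⟨ +-monoʳ-< d (+-monoˡ-< _ (m%n<n p d)) ⟩
  d + (d + (U % d + ilog 2 p * d) * d)     ≡⟨⟩
  d + suc (U % d + ilog 2 p * d) * d       ≤⟨ +-monoʳ-≤ d (*-monoˡ-≤ d (+-mono-≤ (m%n<n U d) (*-monoˡ-≤ d len≤J))) ⟩
  d + (d + J * d) * d                      ≤⟨ +-monoˡ-≤ _ (m≤m*n d (suc J)) ⟩
  d * suc J + (d + J * d) * d              ≡⟨ collect d J ⟩
  (d + d * d) * suc J ∎
  where
  open ≤-Reasoning
  collect : ∀ d J → d * suc J + (d + J * d) * d ≡ (d + d * d) * suc J
  collect = solve-∀

solutionKey-injective : ∀ d .{{_ : NonZero d}} p U p′ U′ → solutionKey d p U ≡ solutionKey d p′ U′ →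
  p ≡ p′ ⊎ (d ≤ p × d ≤ p′ × ilog 2 p ≡ ilog 2 p′ × U % d ≡ U′ % d × p % d ≡ p′ % d)
solutionKey-injective d p U p′ U′ eq with p <? d | p′ <? d
... | yes _ | yes _ = inj₁ eq
... | yes p<d | no _ = ⊥-elim (<⇒≢ (<-≤-trans p<d (m≤m+n d _)) eq)
... | no _ | yes p′<d = ⊥-elim (<⇒≢ (<-≤-trans p′<d (m≤m+n d _)) (sym eq))
... | no p≮d | no p′≮d
  with digit-injective {a = U % d + ilog 2 p * d} {b = U′ % d + ilog 2 p′ * d} (m%n<n p d) (m%n<n p′ d) (+-cancelˡ-≡ d _ _ eq)
...   | p≡p′ , rest with digit-injective {a = ilog 2 p} {b = ilog 2 p′} (m%n<n U d) (m%n<n U′ d) rest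
...     | U≡U′ , len≡ = inj₂ (≮⇒≥ p≮d , ≮⇒≥ p′≮d , len≡ , U≡U′ , p≡p′)

complete-square : ∀ A B C z → (+ 2 ℤ.* A ℤ.* z ℤ.+ B) ℤ.* (+ 2 ℤ.* A ℤ.* z ℤ.+ B) ≡ + 4 ℤ.* A ℤ.* quad A B C z ℤ.+ disc A B C
complete-square = expanded
  where
  expanded : ∀ A B C z → (+ 2 ℤ.* A ℤ.* z ℤ.+ B) ℤ.* (+ 2 ℤ.* A ℤ.* z ℤ.+ B) ≡
    + 4 ℤ.* A ℤ.* (A ℤ.* z ℤ.* z ℤ.+ B ℤ.* z ℤ.+ C) ℤ.+ (B ℤ.* B ℤ.- + 4 ℤ.* A ℤ.* C)
  expanded = ℤSolver.solve-∀

square-abs : ∀ u → + (∣ u ∣ * ∣ u ∣) ≡ u ℤ.* u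
square-abs (+ n) = ℤP.pos-* n n
square-abs -[1+ n ] = refl

prime≥1 : ∀ {p} → Prime p → 1 ≤ p
prime≥1 pr = <⇒≤ (prime>1 pr)

module QuadraticPrimes (A′ : ℕ) (B C : ℤ) (b d a : ℕ) where

  A : ℤ
  A = + suc A′

  D : ℤ
  D = disc A B C

  δ : ℕ
  δ = ∣ D ∣

  E : ℕ
  E = 4 * suc A′ * a

  root : ∀ {p} → InZ A B C b d a p → ℕ
  root (_ , _ , n , _ , _) = ∣ + 2 ℤ.* A ℤ.* + n ℤ.+ B ∣

  root-solves : ∀ {p} (h : InZ A B C b d a p) → + (root h * root h) ≡ + (E * (p * p)) ℤ.+ D
  root-solves {p} h@(_ , _ , n , _ , f[n]≡ap²) = begin
    + (root h * root h)                                       ≡⟨ square-abs (+ 2 ℤ.* A ℤ.* + n ℤ.+ B) ⟩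
    (+ 2 ℤ.* A ℤ.* + n ℤ.+ B) ℤ.* (+ 2 ℤ.* A ℤ.* + n ℤ.+ B) ≡⟨ complete-square A B C (+ n) ⟩
    + 4 ℤ.* A ℤ.* quad A B C (+ n) ℤ.+ D                      ≡⟨ cong (λ v → + 4 ℤ.* A ℤ.* v ℤ.+ D) f[n]≡ap² ⟩
    + 4 ℤ.* A ℤ.* (+ a ℤ.* + p ℤ.* + p) ℤ.+ D                 ≡⟨ cong (ℤ._+ D) coefficient ⟩
    + (E * (p * p)) ℤ.+ D ∎
    where
    open ≡-Reasoning
    coefficient : + 4 ℤ.* A ℤ.* (+ a ℤ.* + p ℤ.* + p) ≡ + (E * (p * p))
    coefficient = begin
      + 4 ℤ.* A ℤ.* (+ a ℤ.* + p ℤ.* + p) ≡⟨ reassoc (+ 4) A (+ a) (+ p) ⟩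
      + 4 ℤ.* A ℤ.* + a ℤ.* (+ p ℤ.* + p) ≡⟨ cong₂ ℤ._*_ (cong (ℤ._* + a) (ℤP.pos-* 4 (suc A′))) (ℤP.pos-* p p) ⟨
      + (4 * suc A′) ℤ.* + a ℤ.* + (p * p) ≡⟨ cong (ℤ._* + (p * p)) (ℤP.pos-* (4 * suc A′) a) ⟨
      + E ℤ.* + (p * p)                   ≡⟨ ℤP.pos-* E (p * p) ⟨
      + (E * (p * p)) ∎
      where
      reassoc : ∀ k A a p → k ℤ.* A ℤ.* (a ℤ.* p ℤ.* p) ≡ k ℤ.* A ℤ.* a ℤ.* (p ℤ.* p)
      reassoc = ℤSolver.solve-∀

  -- Primes with equal keys are in the same dyadic range and have congruent
  -- (U, p) mod δ, so they coincide by Pell rigidity.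
  Z-count : 1 ≤ a → .{{_ : NonZero δ}} → ∀ x {L} → Unique L →
    All (λ p → p ≤ x × InZ A B C b d a p) L → length L ≤ (δ + δ * δ) * suc (ilog 2 x)
  Z-count 1≤a x = pigeonhole _ key key< key-injective
    where
    Good : ℕ → Set
    Good p = p ≤ x × InZ A B C b d a p
    key : ∀ {p} → Good p → ℕ
    key {p} (_ , h) = solutionKey δ p (root h)
    key< : ∀ {p} (g : Good p) → key g < (δ + δ * δ) * suc (ilog 2 x)
    key< {p} (p≤x , h@(p-prime , _)) = solutionKey-< δ p (root h) _ (ilog-mono 1<2 (prime≥1 p-prime) p≤x)
    2≤E : 2 ≤ E
    2≤E = ≤-trans (m≤m+n 2 2) (*-mono-≤ {4} {4 * suc A′} {1} {a} (m≤m*n 4 (suc A′)) 1≤a)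
    key-injective : ∀ {p p′} (g : Good p) (g′ : Good p′) → key g ≡ key g′ → p ≡ p′
    key-injective {p} {p′} (_ , h@(p-prime , _)) (_ , h′@(p′-prime , _)) same
      with solutionKey-injective δ p (root h) p′ (root h′) same
    ... | inj₁ p≡p′ = p≡p′
    ... | inj₂ (δ≤p , δ≤p′ , same-length , U-rem , p-rem) =
      pell-rigidity D E (root h) (root h′) p p′ 2≤E (root-solves h) (root-solves h′) δ≤p δ≤p′
        (ilog₂-close (prime≥1 p-prime) (prime≥1 p′-prime) same-length)
        (ilog₂-close (prime≥1 p′-prime) (prime≥1 p-prime) (sym same-length)) U-rem p-rem

-- Corollary 4.5: T_a(x) = o(π(x)); explicitly, for every k, eventually (k+1)·T_a(x) ≤ π(x).
-- Since D is not a square, D ≠ 0; then T_a(x) ≤ K(⌊log₂ x⌋ + 1) with K = δ + δ², and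
-- π(x) eventually exceeds (k+1)·K(⌊log₂ x⌋ + 1).
corollary4p5 : (A B C : ℤ) → ℤ.0ℤ ℤ.< A → gcd (gcd A B) C ≡ + 1 →
    ((m : ℤ) → m ℤ.* m ≢ disc A B C) →
    (b d : ℕ) →
    ((N : ℕ) → ∃ λ (p : ℕ) → N < p × InAP b d p × LegendreOne (disc A B C) p) →
    (a : ℕ) → 1 ≤ a → (+ a) ℤ.≤ A →
    (k : ℕ) → ∃ λ (X : ℕ) → (x : ℕ) → X ≤ x →
    ScaledCountBounded (InZ A B C b d a) x (suc k) (primeCount x)
corollary4p5 (+ zero) B C (ℤ.+<+ ()) _ _ _ _ _ _ _ _ _
corollary4p5 (+ suc A′) B C _ _ nonsquare b d _ a 1≤a _ k = X , bound
  where
  open QuadraticPrimes A′ B C b d a using (δ; Z-count)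
  instance
    δ≢0 : NonZero δ
    δ≢0 = ℤ.≢-nonZero (λ D≡0 → nonsquare (+ 0) (sym D≡0))
  M = suc k * (δ + δ * δ)
  X = proj₁ (primeCount-beats-log M)
  bound : ∀ x → X ≤ x → ScaledCountBounded (InZ (+ suc A′) B C b d a) x (suc k) (primeCount x)
  bound x X≤x L unique all = begin
    suc k * length L                       ≤⟨ *-monoʳ-≤ (suc k) (Z-count 1≤a x unique all) ⟩
    suc k * ((δ + δ * δ) * suc (ilog 2 x)) ≡⟨ *-assoc (suc k) (δ + δ * δ) (suc (ilog 2 x)) ⟨
    M * suc (ilog 2 x)                     ≤⟨ proj₂ (primeCount-beats-log M) x X≤x ⟩
    primeCount x ∎
    where open ≤-Reasoning
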